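{- Let $\mathcal{S}4$ (Hintikka's epistemic logic) be the modal logic with knowledge operator $K_i$ given by: all propositional tautologies; Distribution $K_i(\varphi\to\psi)\to(K_i\varphi\to K_i\psi)$; Truth $K_i\varphi\to\varphi$; Positive Introspection $K_i\varphi\to K_iK_i\varphi$; modus ponens; and necessitation (from $\vdash\varphi$ infer $\vdash K_i\varphi$). Assume the language expresses Löb sentences for $K_i$, i.e., for every formula $\varphi$ there is a formula $\psi$ such that $\vdash K_i(\psi\leftrightarrow(K_i\psi\to\varphi))$. Then this logic crashes.
   Context: Write $\Diamond$ for the dual $\neg\Box\neg$. "Löb's Theorem for $K_i$" is the scheme $K_i(K_i\varphi\to\varphi)\to K_i\varphi$ for all $\varphi$. The logic is interpreted on frames whose accessibility relation for $K_i$ is reflexive (corresponding to the Truth axiom) and transitive (corresponding to Positive Introspection). Definition: a modal logic with operators $\Box_i$ defined by relations $\mathcal{R}_i$ crashes if and only if its axioms derive Löb's Theorem for at least one $\Box_i$ and $\mathcal{R}_i$ is serial or reflexive. -}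

module Defs where

open import Level using (Level; _⊔_; suc)
open import Data.Nat using (ℕ)
open import Data.Bool using (Bool; true; false; not; _∨_)
open import Data.Product using (Σ; ∃; _×_)
open import Data.Sum using (_⊎_)
open import Relation.Binary.PropositionalEquality using (_≡_)
open import Relation.Binary.Definitions using (Reflexive; Transitive)

-- Further formula formers (e.g. those giving self-reference) may exist;
-- we only require these connectives.
record Language (a f : Level) : Set (suc (a ⊔ f)) where
  field
    Agent : Set a
    Form  : Set f
    ⊥'    : Form
    _⇒_   : Form → Form → Form
    K     : Agent → Form → Form

  infixr 5 _⇒_
  ¬'_ : Form → Form
  ¬' φ = φ ⇒ ⊥'

  _∧'_ : Form → Form → Form
  φ ∧' ψ = ¬' (φ ⇒ ¬' ψ)

  _⇔_ : Form → Form → Form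
  φ ⇔ ψ = (φ ⇒ ψ) ∧' (ψ ⇒ φ)

data PForm : Set where
  var  : ℕ → PForm
  pbot : PForm
  pimp : PForm → PForm → PForm

evalP : (ℕ → Bool) → PForm → Bool
evalP v (var n)    = v n
evalP v pbot       = false
evalP v (pimp p q) = not (evalP v p) ∨ evalP v q

Tautology : PForm → Set
Tautology t = ∀ (v : ℕ → Bool) → evalP v t ≡ true

module _ {a f} (L : Language a f) where
  open Language L

  inst : (ℕ → Form) → PForm → Form
  inst σ (var n)    = σ n
  inst σ pbot       = ⊥'
  inst σ (pimp p q) = inst σ p ⇒ inst σ q

  data S4⊢ : Form → Set (a ⊔ f) where
    taut   : ∀ (t : PForm) → Tautology t → (σ : ℕ → Form) → S4⊢ (inst σ t)
    distr  : ∀ i φ ψ → S4⊢ (K i (φ ⇒ ψ) ⇒ (K i φ ⇒ K i ψ))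
    truth  : ∀ i φ → S4⊢ (K i φ ⇒ φ)
    pintro : ∀ i φ → S4⊢ (K i φ ⇒ K i (K i φ))
    mp     : ∀ {φ ψ} → S4⊢ (φ ⇒ ψ) → S4⊢ φ → S4⊢ ψ
    nec    : ∀ i {φ} → S4⊢ φ → S4⊢ (K i φ)

  ExpressesLöbSentences : Agent → Set (a ⊔ f)
  ExpressesLöbSentences i =
    ∀ (φ : Form) → Σ Form λ ψ → S4⊢ (K i (ψ ⇔ (K i ψ ⇒ φ)))

  DerivesLöb : Agent → Set (a ⊔ f)
  DerivesLöb i = ∀ (φ : Form) → S4⊢ (K i (K i φ ⇒ φ) ⇒ K i φ)

  Serial : ∀ {w r} {W : Set w} → (W → W → Set r) → Set (w ⊔ r)
  Serial {W = W} R = ∀ x → Σ W λ y → R x y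

  Crashes : ∀ {w r} (W : Set w) → (Agent → W → W → Set r) → Set (a ⊔ f ⊔ w ⊔ r)
  Crashes W R = Σ Agent λ i → DerivesLöb i × (Serial (R i) ⊎ Reflexive (R i))

{-# OPTIONS --safe #-}
module Submission where

-- The Löb sentence for ⊥ is a knower sentence ψ ↔ ¬ K ψ, which Truth turns
-- into a paradox: K ψ → ψ → ¬ K ψ refutes K ψ, whence ψ, and necessitation
-- gives K ψ.  So the logic is inconsistent and derives every instance of
-- Löb's theorem, while the relations are reflexive by hypothesis.

open import Defs
open import Level using (Level)
open import Data.Nat using (ℕ; zero; suc)
open import Data.Bool using (true; false)
open import Data.Product using (_×_; _,_; proj₁; proj₂)
open import Data.Sum using (inj₂)
open import Relation.Binary.PropositionalEquality using (refl)
open import Relation.Binary.Definitions using (Reflexive; Transitive)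

p₀ p₁ : PForm
p₀ = var 0
p₁ = var 1

pand : PForm → PForm → PForm
pand a b = pimp (pimp a (pimp b pbot)) pbot

pnot : PForm → PForm
pnot a = pimp a pbot

∧-elimˡ-schema : PForm
∧-elimˡ-schema = pimp (pand p₀ p₁) p₀

∧-elimˡ-taut : Tautology ∧-elimˡ-schema
∧-elimˡ-taut v with v 0 | v 1
... | true  | true  = refl
... | true  | false = refl
... | false | _     = refl

∧-elimʳ-schema : PForm
∧-elimʳ-schema = pimp (pand p₀ p₁) p₁

∧-elimʳ-taut : Tautology ∧-elimʳ-schema
∧-elimʳ-taut v with v 0 | v 1
... | true  | true  = refl
... | true  | false = refl
... | false | true  = refl
... | false | false = refl

ex-falso-schema : PForm
ex-falso-schema = pimp pbot p₀

ex-falso-taut : Tautology ex-falso-schema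
ex-falso-taut v with v 0
... | true  = refl
... | false = refl

self-refutation-schema : PForm
self-refutation-schema = pimp (pimp p₁ p₀) (pimp (pimp p₀ (pnot p₁)) (pnot p₁))

self-refutation-taut : Tautology self-refutation-schema
self-refutation-taut v with v 0 | v 1
... | true  | true  = refl
... | true  | false = refl
... | false | true  = refl
... | false | false = refl

module _ {a f} (L : Language a f) where
  open Language L

  atoms : Form → Form → ℕ → Form
  atoms φ ψ zero          = φ
  atoms φ ψ (suc zero)    = ψ
  atoms φ ψ (suc (suc _)) = ⊥'

  ∧'-elimˡ : ∀ {φ ψ} → S4⊢ L (φ ∧' ψ) → S4⊢ L φ
  ∧'-elimˡ {φ} {ψ} = mp (taut ∧-elimˡ-schema ∧-elimˡ-taut (atoms φ ψ))

  ∧'-elimʳ : ∀ {φ ψ} → S4⊢ L (φ ∧' ψ) → S4⊢ L ψ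
  ∧'-elimʳ {φ} {ψ} = mp (taut ∧-elimʳ-schema ∧-elimʳ-taut (atoms φ ψ))

  ex-falso : ∀ {φ} → S4⊢ L ⊥' → S4⊢ L φ
  ex-falso {φ} = mp (taut ex-falso-schema ex-falso-taut (atoms φ φ))

  ¬'-self-refuting : ∀ {φ ψ} → S4⊢ L (ψ ⇒ φ) → S4⊢ L (φ ⇒ ¬' ψ) → S4⊢ L (¬' ψ)
  ¬'-self-refuting {φ} {ψ} ψ⇒φ φ⇒¬ψ =
    mp (mp (taut self-refutation-schema self-refutation-taut (atoms φ ψ)) ψ⇒φ) φ⇒¬ψ

  knower-paradox : ∀ i {ψ} → S4⊢ L (K i (ψ ⇔ (¬' K i ψ))) → S4⊢ L ⊥'
  knower-paradox i {ψ} knower = mp ¬Kψ Kψ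
    where
      ψ⇔¬Kψ : S4⊢ L (ψ ⇔ (¬' K i ψ))
      ψ⇔¬Kψ = mp (truth i _) knower

      ¬Kψ : S4⊢ L (¬' K i ψ)
      ¬Kψ = ¬'-self-refuting (truth i ψ) (∧'-elimˡ ψ⇔¬Kψ)

      Kψ : S4⊢ L (K i ψ)
      Kψ = nec i (mp (∧'-elimʳ ψ⇔¬Kψ) ¬Kψ)

  löb-sentences⇒inconsistent : ∀ i → ExpressesLöbSentences L i → S4⊢ L ⊥'
  löb-sentences⇒inconsistent i löb = knower-paradox i (proj₂ (löb ⊥'))

theorem2 : ∀ {a f w r : Level} (L : Language a f) (i : Language.Agent L)
             (W : Set w) (R : Language.Agent L → W → W → Set r) →
             (∀ j → Reflexive (R j) × Transitive (R j)) →
             ExpressesLöbSentences L i →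
             Crashes L W R
theorem2 L i W R frames löb =
  i , (λ φ → ex-falso L (löb-sentences⇒inconsistent L i löb)) , inj₂ (proj₁ (frames i))
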